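{- Fix an interpretation $f:\{0,1\}\to\{\emptyset,0,1,E\}$ and a bit string $x=x_1\cdots x_n\in\{0,1\}^n$. Let $G$ be the graph on vertex set $\{1,\dots,n\}$ in which vertex $t$ carries the label $\ell(t)=x_t$, and for $i<t$ the pair $\{i,t\}$ is an edge if and only if either $f(x_t)=E$, or $f(x_t)\in\{0,1\}$ and $f(x_t)=\ell(i)$. Then $G$ is either a threshold graph, or is isomorphic to one of the following graphs for some bit string $y\in\{0,1\}^n$ having $l$ zeros and $m$ ones ($l+m=n$): $E_l\uplus E_m$, $E_{(y)}$, $K_l\uplus E_m$, $K_{l,m}$, $K_{(y)}$, $K_l+E_m$, $K_l\uplus K_m$, $\widetilde K_{(y)}$, $K_{l+m}$.
   Context: This formalizes a model where at each time step $t$ a builder receives one instruction bit $x_t$, adds vertex $t$, stores one bit of memory (the label $x_t$) for it, and connects the new vertex to all earlier vertices ($E$), none ($\emptyset$), or all earlier vertices with a given label ($0$ or $1$); no edges among earlier vertices are ever added. A threshold graph is a graph obtainable from $K_1$ by repeatedly adding an isolated or a dominating vertex. $E_k$ is the edgeless graph on $k$ vertices, $K_k$ the complete graph, $K_{l,m}$ the complete bipartite graph, $\uplus$ the disjoint union, and $G+H$ the join (disjoint union plus all edges between $V(G)$ and $V(H)$). For $y\in\{0,1\}^n$, all three graphs below have vertex set $\{1,\dots,n\}$, with vertex $i$ labelled $y_i$: $E_{(y)}$ has no edges between equally labelled vertices, and a $0$-labelled vertex $i$ is adjacent to a $1$-labelled vertex $j$ iff $j<i$. $K_{(y)}$ has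 all $0$-labelled vertices pairwise adjacent, all $1$-labelled vertices pairwise nonadjacent, and a $0$-labelled $i$ adjacent to a $1$-labelled $j$ iff $i<j$. $\widetilde K_{(y)}$ has all $0$-labelled vertices pairwise adjacent, all $1$-labelled vertices pairwise adjacent, and a $0$-labelled $i$ adjacent to a $1$-labelled $j$ iff $i<j$. -}

module Defs where

open import Data.Bool using (Bool; true; false; not; _∧_; _∨_; if_then_else_)
open import Data.Nat using (ℕ; zero; suc)
open import Data.Fin using (Fin; toℕ; _<?_; _≟_)
open import Data.Vec using (Vec; lookup)
open import Data.Product using (Σ)
open import Data.Empty using (⊥)
open import Data.Sum using (_⊎_)
open import Function.Bundles using (_↔_; Inverse)
open import Relation.Nullary using (does)
open import Relation.Binary.PropositionalEquality using (_≡_)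

-- A (simple, loopless, undirected) graph on vertex set Fin n, given by a
-- Boolean adjacency function.  All graphs defined below are symmetric and
-- irreflexive by construction.
Graph : ℕ → Set
Graph n = Fin n → Fin n → Bool

_≅_ : {n : ℕ} → Graph n → Graph n → Set
_≅_ {n} G H = Σ (Fin n ↔ Fin n) λ σ →
  ∀ i j → G i j ≡ H (Inverse.to σ i) (Inverse.to σ j)

_<ᵇ_ : {n : ℕ} → Fin n → Fin n → Bool
i <ᵇ j = does (i <? j)

_≢ᵇ_ : {n : ℕ} → Fin n → Fin n → Bool
i ≢ᵇ j = not (does (i ≟ j))

fromRule : {n : ℕ} → (Fin n → Fin n → Bool) → Graph n
fromRule r i j =
  if i <ᵇ j then r i j else (if j <ᵇ i then r j i else false)

-- What the new vertex connects to: nothing (∅), the earlier vertices with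
-- label 0, those with label 1, or all earlier vertices (E).
-- Labels are Bools: false = 0, true = 1.
data Action : Set where
  ∅ act0 act1 E : Action

Interpretation : Set
Interpretation = Bool → Action

connects : Action → Bool → Bool
connects ∅    b = false
connects act0 b = not b
connects act1 b = b
connects E    b = true

builtGraph : {n : ℕ} → Interpretation → Vec Bool n → Graph n
builtGraph f x = fromRule λ i t → connects (f (lookup x t)) (lookup x i)

-- Threshold graphs: obtainable from K₁ by repeatedly adding an isolated
-- (bit false) or a dominating (bit true) vertex.  Vertex 0 is the initial
-- K₁, vertex t (t ≥ 1) is the t-th added vertex, with type b_{t-1}.

thresholdBuild : {k : ℕ} → Vec Bool k → Graph (suc k)
thresholdBuild {k} b = fromRule rule
  where
  rule : Fin (suc k) → Fin (suc k) → Bool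
  rule i Fin.zero    = false            -- impossible for i < j
  rule i (Fin.suc t) = lookup b t

IsThreshold : {n : ℕ} → Graph n → Set
IsThreshold {zero}  G = ⊥
IsThreshold {suc k} G = Σ (Vec Bool k) λ b → G ≅ thresholdBuild b

-- The nine exceptional graph families, on vertex set Fin n with vertex i
-- labelled y_i; the l zeros and m ones of y (l + m = n) form the two parts.

E⊎E : {n : ℕ} → Vec Bool n → Graph n
E⊎E y i j = false

E⟨_⟩ : {n : ℕ} → Vec Bool n → Graph n
E⟨ y ⟩ i j = go (lookup y i) (lookup y j)
  where
  go : Bool → Bool → Bool
  go false true  = j <ᵇ i
  go true  false = i <ᵇ j
  go _     _     = false

K⊎E : {n : ℕ} → Vec Bool n → Graph n
K⊎E y i j = not (lookup y i) ∧ not (lookup y j) ∧ (i ≢ᵇ j)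

Kbip : {n : ℕ} → Vec Bool n → Graph n
Kbip y i j = go (lookup y i) (lookup y j)
  where
  go : Bool → Bool → Bool
  go false true  = true
  go true  false = true
  go _     _     = false

K⟨_⟩ : {n : ℕ} → Vec Bool n → Graph n
K⟨ y ⟩ i j = go (lookup y i) (lookup y j)
  where
  go : Bool → Bool → Bool
  go false false = i ≢ᵇ j
  go true  true  = false
  go false true  = i <ᵇ j
  go true  false = j <ᵇ i

K+E : {n : ℕ} → Vec Bool n → Graph n
K+E y i j = (i ≢ᵇ j) ∧ not (lookup y i ∧ lookup y j)

K⊎K : {n : ℕ} → Vec Bool n → Graph n
K⊎K y i j = go (lookup y i) (lookup y j)
  where
  go : Bool → Bool → Bool
  go false false = i ≢ᵇ j
  go true  true  = i ≢ᵇ j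
  go _     _     = false

K̃⟨_⟩ : {n : ℕ} → Vec Bool n → Graph n
K̃⟨ y ⟩ i j = go (lookup y i) (lookup y j)
  where
  go : Bool → Bool → Bool
  go false false = i ≢ᵇ j
  go true  true  = i ≢ᵇ j
  go false true  = i <ᵇ j
  go true  false = j <ᵇ i

Kall : {n : ℕ} → Vec Bool n → Graph n
Kall y i j = i ≢ᵇ j

IsExceptional : {n : ℕ} → Graph n → Set
IsExceptional {n} G = Σ (Vec Bool n) λ y →
  (G ≅ E⊎E y) ⊎ (G ≅ E⟨ y ⟩) ⊎ (G ≅ K⊎E y) ⊎ (G ≅ Kbip y) ⊎ (G ≅ K⟨ y ⟩)
  ⊎ (G ≅ K+E y) ⊎ (G ≅ K⊎K y) ⊎ (G ≅ K̃⟨ y ⟩) ⊎ (G ≅ Kall y)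

-- The graph depends only on the pair of actions (f 0, f 1).  If neither action
-- looks at the label of the earlier vertex (both are ∅ or E), every new vertex is
-- isolated or dominating, so the graph is threshold.  Complementing all labels
-- turns the builder for (a₀, a₁) into the builder for (dual a₁, dual a₀), where
-- dual exchanges the actions 0 and 1; this reduces the twelve remaining pairs to
-- seven, and each of those builds one of the listed graphs with y = x.
module Submission where

open import Defs
open import Data.Nat using (ℕ; suc)
open import Data.Bool using (Bool; true; false; not; _∧_)
open import Data.Bool.Properties using (not-involutive; ∧-identityʳ; ∧-zeroʳ)
open import Data.Vec using (Vec; []; lookup; map; tabulate)
open import Data.Vec.Properties using (lookup-map; lookup∘tabulate)
open import Data.Sum using (_⊎_; inj₁; inj₂)
open import Data.Product as Product using (_×_; _,_)
open import Data.Fin using (Fin; _<_; _<?_; _≟_)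
open import Data.Fin.Properties using (<-cmp; <-asym; <-irrefl; <⇒≢)
open import Function using (_∘_)
open import Function.Properties.Inverse using (↔-refl)
open import Relation.Binary.Definitions using (tri<; tri≈; tri>)
open import Relation.Nullary.Decidable using (dec-true; dec-false)
open import Relation.Binary.PropositionalEquality
  using (_≡_; _≗_; refl; sym; trans; cong)

infix 4 _≐_

_≐_ : {n : ℕ} → Graph n → Graph n → Set
G ≐ H = ∀ i j → G i j ≡ H i j

≐-trans : {n : ℕ} {G H K : Graph n} → G ≐ H → H ≐ K → G ≐ K
≐-trans G≐H H≐K i j = trans (G≐H i j) (H≐K i j)

≐⇒≅ : {n : ℕ} {G H : Graph n} → G ≐ H → G ≅ H
≐⇒≅ G≐H = ↔-refl , G≐H

<ᵇ-irrefl : {n : ℕ} (i : Fin n) → (i <ᵇ i) ≡ false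
<ᵇ-irrefl i = dec-false (i <? i) (<-irrefl refl)

≢ᵇ-irrefl : {n : ℕ} (i : Fin n) → (i ≢ᵇ i) ≡ false
≢ᵇ-irrefl i = cong not (dec-true (i ≟ i) refl)

module _ {n : ℕ} {i j : Fin n} (i<j : i < j) where

  <⇒<ᵇ : (i <ᵇ j) ≡ true
  <⇒<ᵇ = dec-true (i <? j) i<j

  <⇒≯ᵇ : (j <ᵇ i) ≡ false
  <⇒≯ᵇ = dec-false (j <? i) (<-asym i<j)

  <⇒≢ᵇ : (i ≢ᵇ j) ≡ true × (j ≢ᵇ i) ≡ true
  <⇒≢ᵇ = cong not (dec-false (i ≟ j) (<⇒≢ i<j)) , cong not (dec-false (j ≟ i) (<⇒≢ i<j ∘ sym))

Loopless : {n : ℕ} → Graph n → Set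
Loopless H = ∀ i → H i i ≡ false

AgreesOnPairs : {n : ℕ} → (Fin n → Fin n → Bool) → Graph n → Set
AgreesOnPairs r H = ∀ {i j} → i < j → H i j ≡ r i j × H j i ≡ r i j

module _ {n : ℕ} (r : Fin n → Fin n → Bool) where

  fromRule-irrefl : ∀ i → fromRule r i i ≡ false
  fromRule-irrefl i rewrite <ᵇ-irrefl i = refl

  fromRule-< : ∀ {i j} → i < j → fromRule r i j ≡ r i j
  fromRule-< i<j rewrite <⇒<ᵇ i<j = refl

  fromRule-> : ∀ {i j} → i < j → fromRule r j i ≡ r i j
  fromRule-> i<j rewrite <⇒≯ᵇ i<j | <⇒<ᵇ i<j = refl

  fromRule-unique : {H : Graph n} → Loopless H → AgreesOnPairs r H → fromRule r ≐ H
  fromRule-unique H-loopless H-agrees i j with <-cmp i j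
  ... | tri< i<j _ _    = let Hij , _ = H-agrees i<j in trans (fromRule-< i<j) (sym Hij)
  ... | tri≈ _ refl _   = trans (fromRule-irrefl i) (sym (H-loopless i))
  ... | tri> _ _ j<i    = let _ , Hij = H-agrees j<i in trans (fromRule-> j<i) (sym Hij)

fromRule-cong : {n : ℕ} {r r′ : Fin n → Fin n → Bool} →
  (∀ {i j} → i < j → r i j ≡ r′ i j) → fromRule r ≐ fromRule r′
fromRule-cong {r = r} {r′} r≡r′ =
  fromRule-unique r (fromRule-irrefl r′)
    λ i<j → trans (fromRule-< r′ i<j) (sym (r≡r′ i<j))
          , trans (fromRule-> r′ i<j) (sym (r≡r′ i<j))

thresholdBuild-irrefl : {k : ℕ} (b : Vec Bool k) (i : Fin (suc k)) → thresholdBuild b i i ≡ false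
thresholdBuild-irrefl b i rewrite <ᵇ-irrefl i = refl

module _ {k : ℕ} (b : Vec Bool k) {i : Fin (suc k)} (t : Fin k) (i<t : i < Fin.suc t) where

  thresholdBuild-< : thresholdBuild b i (Fin.suc t) ≡ lookup b t
  thresholdBuild-< rewrite <⇒<ᵇ i<t = refl

  thresholdBuild-> : thresholdBuild b (Fin.suc t) i ≡ lookup b t
  thresholdBuild-> rewrite <⇒≯ᵇ i<t | <⇒<ᵇ i<t = refl

fromRule-threshold : {k : ℕ} (r : Fin (suc k) → Fin (suc k) → Bool) (d : Fin k → Bool) →
  (∀ i t → r i (Fin.suc t) ≡ d t) → fromRule r ≐ thresholdBuild (tabulate d)
fromRule-threshold r d r≡d = fromRule-unique r (thresholdBuild-irrefl _) new-vertex-type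
  where
  new-vertex-type : AgreesOnPairs r (thresholdBuild (tabulate d))
  new-vertex-type {i} {Fin.suc t} i<t =
    trans (thresholdBuild-< _ t i<t) d≡r , trans (thresholdBuild-> _ t i<t) d≡r
    where
    d≡r : lookup (tabulate d) t ≡ r i (Fin.suc t)
    d≡r = trans (lookup∘tabulate d t) (sym (r≡d i t))

interpretation : Action → Action → Interpretation
interpretation a₀ a₁ false = a₀
interpretation a₀ a₁ true  = a₁

interpretation-η : (f : Interpretation) → f ≗ interpretation (f false) (f true)
interpretation-η f false = refl
interpretation-η f true  = refl

dual : Action → Action
dual ∅    = ∅
dual act0 = act1
dual act1 = act0
dual E    = E

connects-dual : ∀ a b → connects (dual a) (not b) ≡ connects a b
connects-dual ∅    b = refl
connects-dual act0 b = refl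
connects-dual act1 b = not-involutive b
connects-dual E    b = refl

interpretation-dual : ∀ a₀ a₁ → dual ∘ interpretation a₀ a₁ ∘ not ≗ interpretation (dual a₁) (dual a₀)
interpretation-dual a₀ a₁ false = refl
interpretation-dual a₀ a₁ true  = refl

data LabelBlind : Action → Set where
  isolated   : LabelBlind ∅
  dominating : LabelBlind E

connects-blind : ∀ {a} → LabelBlind a → ∀ b → connects a b ≡ connects a false
connects-blind isolated   b = refl
connects-blind dominating b = refl

builderRule : {n : ℕ} → Interpretation → Vec Bool n → Fin n → Fin n → Bool
builderRule f x i t = connects (f (lookup x t)) (lookup x i)

module _ {n : ℕ} where

  builtGraph-cong : {f f′ : Interpretation} (x : Vec Bool n) →
    f ≗ f′ → builtGraph f x ≐ builtGraph f′ x
  builtGraph-cong x f≗f′ = fromRule-cong λ {_} {t} _ →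
    cong (λ a → connects a _) (f≗f′ (lookup x t))

  builtGraph-complement : (f : Interpretation) (x : Vec Bool n) →
    builtGraph f x ≐ builtGraph (dual ∘ f ∘ not) (map not x)
  builtGraph-complement f x = fromRule-cong λ {i} {t} _ → sym (complemented-edge i t)
    where
    complemented-edge : ∀ i t → builderRule (dual ∘ f ∘ not) (map not x) i t ≡ builderRule f x i t
    complemented-edge i t rewrite lookup-map i not x | lookup-map t not x | not-involutive (lookup x t)
      = connects-dual (f (lookup x t)) (lookup x i)

  interpretation-complement : ∀ a₀ a₁ (x : Vec Bool n) →
    builtGraph (interpretation a₀ a₁) x ≐ builtGraph (interpretation (dual a₁) (dual a₀)) (map not x)
  interpretation-complement a₀ a₁ x = ≐-trans (builtGraph-complement (interpretation a₀ a₁) x)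
    (builtGraph-cong {f = dual ∘ interpretation a₀ a₁ ∘ not} (map not x) (interpretation-dual a₀ a₁))

builtGraph-threshold : {k : ℕ} (f : Interpretation) (x : Vec Bool (suc k)) →
  (∀ b → LabelBlind (f b)) →
  builtGraph f x ≐ thresholdBuild (tabulate λ t → connects (f (lookup x (Fin.suc t))) false)
builtGraph-threshold f x blind = fromRule-threshold _ _ λ i t →
  connects-blind (blind (lookup x (Fin.suc t))) (lookup x i)

module _ {n : ℕ} (y : Vec Bool n) where

  K⊎E-built : builtGraph (interpretation act0 ∅) y ≐ K⊎E y
  K⊎E-built = fromRule-unique _ loopless agrees
    where
    loopless : Loopless (K⊎E y)
    loopless i with lookup y i
    ... | false = ≢ᵇ-irrefl i
    ... | true  = refl
    agrees : AgreesOnPairs (builderRule (interpretation act0 ∅) y) (K⊎E y)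
    agrees {i} {j} i<j with lookup y i | lookup y j
    ... | false | false = <⇒≢ᵇ i<j
    ... | false | true  = refl , refl
    ... | true  | false = refl , refl
    ... | true  | true  = refl , refl

  E⟨⟩-built : builtGraph (interpretation act1 ∅) y ≐ E⟨ y ⟩
  E⟨⟩-built = fromRule-unique _ loopless agrees
    where
    loopless : Loopless E⟨ y ⟩
    loopless i with lookup y i
    ... | false = refl
    ... | true  = refl
    agrees : AgreesOnPairs (builderRule (interpretation act1 ∅) y) E⟨ y ⟩
    agrees {i} {j} i<j with lookup y i | lookup y j
    ... | false | false = refl , refl
    ... | false | true  = <⇒≯ᵇ i<j , <⇒≯ᵇ i<j
    ... | true  | false = <⇒<ᵇ i<j , <⇒<ᵇ i<j
    ... | true  | true  = refl , refl

  Kbip-built : builtGraph (interpretation act1 act0) y ≐ Kbip y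
  Kbip-built = fromRule-unique _ loopless agrees
    where
    loopless : Loopless (Kbip y)
    loopless i with lookup y i
    ... | false = refl
    ... | true  = refl
    agrees : AgreesOnPairs (builderRule (interpretation act1 act0) y) (Kbip y)
    agrees {i} {j} i<j with lookup y i | lookup y j
    ... | false | false = refl , refl
    ... | false | true  = refl , refl
    ... | true  | false = refl , refl
    ... | true  | true  = refl , refl

  K⟨⟩-built : builtGraph (interpretation act0 act0) y ≐ K⟨ y ⟩
  K⟨⟩-built = fromRule-unique _ loopless agrees
    where
    loopless : Loopless K⟨ y ⟩
    loopless i with lookup y i
    ... | false = ≢ᵇ-irrefl i
    ... | true  = refl
    agrees : AgreesOnPairs (builderRule (interpretation act0 act0) y) K⟨ y ⟩
    agrees {i} {j} i<j with lookup y i | lookup y j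
    ... | false | false = <⇒≢ᵇ i<j
    ... | false | true  = <⇒<ᵇ i<j , <⇒<ᵇ i<j
    ... | true  | false = <⇒≯ᵇ i<j , <⇒≯ᵇ i<j
    ... | true  | true  = refl , refl

  K+E-built : builtGraph (interpretation E act0) y ≐ K+E y
  K+E-built = fromRule-unique _ loopless agrees
    where
    loopless : Loopless (K+E y)
    loopless i rewrite ≢ᵇ-irrefl i = refl
    distinct : ∀ {i j} → i < j → ((i ≢ᵇ j) ∧ true) ≡ true × ((j ≢ᵇ i) ∧ true) ≡ true
    distinct i<j = Product.map (cong (_∧ true)) (cong (_∧ true)) (<⇒≢ᵇ i<j)
    agrees : AgreesOnPairs (builderRule (interpretation E act0) y) (K+E y)
    agrees {i} {j} i<j with lookup y i | lookup y j
    ... | false | false = distinct i<j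
    ... | false | true  = distinct i<j
    ... | true  | false = distinct i<j
    ... | true  | true  = ∧-zeroʳ (i ≢ᵇ j) , ∧-zeroʳ (j ≢ᵇ i)

  K⊎K-built : builtGraph (interpretation act0 act1) y ≐ K⊎K y
  K⊎K-built = fromRule-unique _ loopless agrees
    where
    loopless : Loopless (K⊎K y)
    loopless i with lookup y i
    ... | false = ≢ᵇ-irrefl i
    ... | true  = ≢ᵇ-irrefl i
    agrees : AgreesOnPairs (builderRule (interpretation act0 act1) y) (K⊎K y)
    agrees {i} {j} i<j with lookup y i | lookup y j
    ... | false | false = <⇒≢ᵇ i<j
    ... | false | true  = refl , refl
    ... | true  | false = refl , refl
    ... | true  | true  = <⇒≢ᵇ i<j

  K̃⟨⟩-built : builtGraph (interpretation act0 E) y ≐ K̃⟨ y ⟩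
  K̃⟨⟩-built = fromRule-unique _ loopless agrees
    where
    loopless : Loopless K̃⟨ y ⟩
    loopless i with lookup y i
    ... | false = ≢ᵇ-irrefl i
    ... | true  = ≢ᵇ-irrefl i
    agrees : AgreesOnPairs (builderRule (interpretation act0 E) y) K̃⟨ y ⟩
    agrees {i} {j} i<j with lookup y i | lookup y j
    ... | false | false = <⇒≢ᵇ i<j
    ... | false | true  = <⇒<ᵇ i<j , <⇒<ᵇ i<j
    ... | true  | false = <⇒≯ᵇ i<j , <⇒≯ᵇ i<j
    ... | true  | true  = <⇒≢ᵇ i<j

pattern is-E⊎E  G≅ = inj₁ G≅
pattern is-E⟨⟩  G≅ = inj₂ (inj₁ G≅)
pattern is-K⊎E  G≅ = inj₂ (inj₂ (inj₁ G≅))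
pattern is-Kbip G≅ = inj₂ (inj₂ (inj₂ (inj₁ G≅)))
pattern is-K⟨⟩  G≅ = inj₂ (inj₂ (inj₂ (inj₂ (inj₁ G≅))))
pattern is-K+E  G≅ = inj₂ (inj₂ (inj₂ (inj₂ (inj₂ (inj₁ G≅)))))
pattern is-K⊎K  G≅ = inj₂ (inj₂ (inj₂ (inj₂ (inj₂ (inj₂ (inj₁ G≅))))))
pattern is-K̃⟨⟩  G≅ = inj₂ (inj₂ (inj₂ (inj₂ (inj₂ (inj₂ (inj₂ (inj₁ G≅)))))))

module _ {k : ℕ} (x : Vec Bool (suc k)) {G : Graph (suc k)} where

  private
    threshold : ∀ {a₀ a₁} → LabelBlind a₀ → LabelBlind a₁ →
      G ≐ builtGraph (interpretation a₀ a₁) x → IsThreshold G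
    threshold {a₀} {a₁} blind₀ blind₁ G≐ = _ , ≐⇒≅ (≐-trans G≐
      (builtGraph-threshold (interpretation a₀ a₁) x λ { false → blind₀ ; true → blind₁ }))

    direct : ∀ {a₀ a₁} {H : Graph (suc k)} →
      G ≐ builtGraph (interpretation a₀ a₁) x → builtGraph (interpretation a₀ a₁) x ≐ H → G ≅ H
    direct G≐ built≐ = ≐⇒≅ (≐-trans G≐ built≐)

    complemented : ∀ {a₀ a₁} {H : Graph (suc k)} → G ≐ builtGraph (interpretation a₀ a₁) x →
      builtGraph (interpretation (dual a₁) (dual a₀)) (map not x) ≐ H → G ≅ H
    complemented {a₀} {a₁} G≐ built≐ =
      ≐⇒≅ (≐-trans G≐ (≐-trans (interpretation-complement a₀ a₁ x) built≐))

  classification : ∀ a₀ a₁ → G ≐ builtGraph (interpretation a₀ a₁) x →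
    IsThreshold G ⊎ IsExceptional G
  classification ∅    ∅    G≐ = inj₁ (threshold isolated isolated G≐)
  classification ∅    E    G≐ = inj₁ (threshold isolated dominating G≐)
  classification E    ∅    G≐ = inj₁ (threshold dominating isolated G≐)
  classification E    E    G≐ = inj₁ (threshold dominating dominating G≐)
  classification act0 ∅    G≐ = inj₂ (x , is-K⊎E  (direct G≐ (K⊎E-built x)))
  classification act1 ∅    G≐ = inj₂ (x , is-E⟨⟩  (direct G≐ (E⟨⟩-built x)))
  classification act1 act0 G≐ = inj₂ (x , is-Kbip (direct G≐ (Kbip-built x)))
  classification act0 act0 G≐ = inj₂ (x , is-K⟨⟩  (direct G≐ (K⟨⟩-built x)))
  classification E    act0 G≐ = inj₂ (x , is-K+E  (direct G≐ (K+E-built x)))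
  classification act0 act1 G≐ = inj₂ (x , is-K⊎K  (direct G≐ (K⊎K-built x)))
  classification act0 E    G≐ = inj₂ (x , is-K̃⟨⟩  (direct G≐ (K̃⟨⟩-built x)))
  classification ∅    act1 G≐ = inj₂ (map not x , is-K⊎E (complemented G≐ (K⊎E-built (map not x))))
  classification ∅    act0 G≐ = inj₂ (map not x , is-E⟨⟩ (complemented G≐ (E⟨⟩-built (map not x))))
  classification act1 act1 G≐ = inj₂ (map not x , is-K⟨⟩ (complemented G≐ (K⟨⟩-built (map not x))))
  classification act1 E    G≐ = inj₂ (map not x , is-K+E (complemented G≐ (K+E-built (map not x))))
  classification E    act1 G≐ = inj₂ (map not x , is-K̃⟨⟩ (complemented G≐ (K̃⟨⟩-built (map not x))))

proposition3 : (f : Interpretation) (n : ℕ) (x : Vec Bool n) →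
    IsThreshold (builtGraph f x) ⊎ IsExceptional (builtGraph f x)
-- Threshold graphs start from K₁, so the empty graph is covered only by the list.
proposition3 f 0       [] = inj₂ ([] , is-E⊎E (↔-refl , λ ()))
proposition3 f (suc k) x  =
  classification x (f false) (f true) (builtGraph-cong {f = f} x (interpretation-η f))
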